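{- Let $R_5(z)=\sum_{n\ge0} b_n \frac{z^n}{n!}$, where $b_n$ is the number of relaxed binary trees of size $n$ with right height at most one in which every internal node on level $0$ is a branch node. Let $F_n$ be the Fibonacci numbers, $F_0=0$, $F_1=1$, $F_n=F_{n-1}+F_{n-2}$ for $n\ge2$. Then, as formal power series, $$R_5(z)=\exp\Big(\sum_{n\ge1}\frac{F_{n-1}z^n}{n}\Big).$$
   Context: A binary tree of size $n$ is a rooted plane tree with $n$ internal nodes, each having an ordered left and right child, and $n+1$ leaves. A relaxed binary tree of size $n$ is obtained from a binary tree of size $n$ by keeping the first leaf in postorder traversal (the unique leaf) and replacing every other leaf by a pointer to some node (internal node or the kept leaf) that has already been visited in the postorder traversal when that leaf position is reached. Two relaxed binary trees are equal iff they have the same underlying binary tree and the same pointer targets. The size is the number of internal nodes (the size-$0$ object is a single leaf). In the tree obtained by deleting all pointers, the level of a node is the number of right edges on the path from the root to it, and the right height is the maximal number of right edges on any root-to-leaf path. A branch node is a level-$0$ internal node whose right child is an internal node (rather than a pointer). The first coefficients $b_0,b_1,\dots$ are $1,0,1,2,15,92,835$. -}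

module Defs where

open import Data.Nat as ℕ using (ℕ; zero; suc; _⊔_; _!; _≤_)
open import Data.Nat.Properties using (_!≢0)
open import Data.Fin using (Fin)
open import Data.Integer using (+_)
open import Data.Rational using (ℚ; 0ℚ; 1ℚ; _/_; _+_; _*_)
open import Data.Product using (Σ; _×_)
open import Data.Unit using (⊤)
open import Data.Empty using (⊥)

-- Rel v n v' : a relaxed subtree of size n (n internal nodes), traversed
-- in postorder, starting when v nodes (internal nodes or the unique leaf)
-- have already been visited and ending when v' nodes have been visited.
-- * uleaf : the unique leaf = first leaf in postorder (only when v = 0);
--           visiting it makes 1 node visited.
-- * ptr i : a pointer leaf; its target is the i-th already visited node
--           (in postorder), i : Fin v, v ≥ 1.  Pointers are not nodes.
-- * node l r : internal node; visited after its two subtrees.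

data Rel : ℕ → ℕ → ℕ → Set where
  uleaf : Rel 0 0 1
  ptr   : ∀ {v} → Fin (suc v) → Rel (suc v) 0 (suc v)
  node  : ∀ {v n₁ v₁ n₂ v₂} → Rel v n₁ v₁ → Rel v₁ n₂ v₂ →
          Rel v (suc (n₁ ℕ.+ n₂)) (suc v₂)

RelaxedTree : ℕ → Set
RelaxedTree n = Rel 0 n (suc n)

IsNode : ∀ {v n v'} → Rel v n v' → Set
IsNode (node _ _) = ⊤
IsNode uleaf      = ⊥
IsNode (ptr _)    = ⊥

-- Right height of the tree obtained by deleting all pointers:
-- maximal number of right edges on a root-to-leaf path.
mutual
  rightHeight : ∀ {v n v'} → Rel v n v' → ℕ
  rightHeight uleaf      = 0
  rightHeight (ptr _)    = 0
  rightHeight (node l r) = leftContribution l ⊔ rightContribution r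

  leftContribution : ∀ {v n v'} → Rel v n v' → ℕ
  leftContribution (ptr _) = 0
  leftContribution t       = rightHeight t

  rightContribution : ∀ {v n v'} → Rel v n v' → ℕ
  rightContribution (node l r) = suc (rightHeight (node l r))
  rightContribution uleaf      = 0
  rightContribution (ptr _)    = 0

-- Every internal node on level 0 (the left spine from the root) is a
-- branch node, i.e. its right child is an internal node.
Level0Branch : ∀ {v n v'} → Rel v n v' → Set
Level0Branch uleaf      = ⊤
Level0Branch (ptr _)    = ⊤
Level0Branch (node l r) = IsNode r × Level0Branch l

R5Tree : ℕ → Set
R5Tree n = Σ (RelaxedTree n) λ t → (rightHeight t ≤ 1) × Level0Branch t

Series : Set
Series = ℕ → ℚ

sumTo : ℕ → (ℕ → ℚ) → ℚ
sumTo zero    f = f 0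
sumTo (suc n) f = sumTo n f + f (suc n)

_⋆_ : Series → Series → Series
(f ⋆ g) n = sumTo n (λ i → f i * g (n ℕ.∸ i))

oneS : Series
oneS zero    = 1ℚ
oneS (suc _) = 0ℚ

_^S_ : Series → ℕ → Series
f ^S zero  = oneS
f ^S suc k = f ⋆ (f ^S k)

inv! : ℕ → ℚ
inv! k = (+ 1 / (k !)) {{k !≢0}}

-- exp(G) = Σ_{k≥0} G^k / k!  for G with zero constant term; the n-th
-- coefficient only receives contributions from k ≤ n.
expS : Series → Series
expS G n = sumTo n (λ k → (G ^S k) n * inv! k)

fib : ℕ → ℕ
fib zero          = 0
fib (suc zero)    = 1
fib (suc (suc n)) = fib (suc n) ℕ.+ fib n

fibLogSeries : Series
fibLogSeries zero    = 0ℚ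
fibLogSeries (suc n) = + fib n / suc n

ℕtoℚ : ℕ → ℚ
ℕtoℚ m = + m / 1

-- An R5 tree of size n+1 is a root whose left subtree is an R5 tree of some size a and whose right
-- subtree is a nonempty left path of size c+1 (a + c = n), all of whose right children and whose bottom
-- leaf are pointers.  Counting the pointer choices gives r(n+1) = Σ_{a+c=n} r(a) (a+1)(a+1)(a+2)⋯(a+c+1),
-- which collapses to r(n+2) = (n+1) r(n+1) + (n+1)² r(n).  On the other side E = exp G satisfies
-- θE = θG · E for the Euler operator θ = z d/dz, and θG = Σ F_{n-1} z^n = z²/(1 - z - z²) turns this into
-- (n+2) E_{n+2} = (n+1) E_{n+1} + (n+1) E_n, so n! E_n satisfies the same recurrence as r(n).

module Submission where

open import Defs

module TreeCounting where

  open import Data.Nat using (ℕ; zero; suc; _+_; _*_; _⊔_; _≤_; _<_; z≤n; s≤s)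
  open import Data.Nat.Induction using (<-rec)
  import Data.Nat.Properties as ℕ
  open import Data.Fin using (Fin)
  open import Data.Fin.Properties using (+↔⊎; *↔×; 1↔⊤)
  open import Data.Product using (Σ; _×_; _,_; proj₁; proj₂)
  open import Data.Product.Function.NonDependent.Propositional using (_×-↔_)
  open import Data.Product.Function.Dependent.Propositional using (Σ-↔)
  open import Data.Sum using (_⊎_; inj₁; inj₂)
  open import Data.Sum.Function.Propositional using (_⊎-↔_)
  open import Data.Unit using (⊤; tt)
  open import Data.Empty using (⊥-elim)
  open import Function.Base using (_∘_; _⟨_⟩_)
  open import Function.Bundles using (_↔_; _⇔_; mk↔ₛ′; mk⇔; Equivalence)
  open import Function.Properties.Inverse using (↔-refl; ↔-trans; ↔-sym)
  open import Function.Related.Propositional using (module EquationalReasoning)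
  open import Function.Related.TypeIsomorphisms using (Σ-assoc)
  open import Relation.Nullary using (¬_)
  open import Relation.Nullary.Irrelevant using (Irrelevant)
  open import Relation.Binary.PropositionalEquality
  open import Relation.Binary.PropositionalEquality.Properties using (subst-subst-sym; subst-sym-subst)
  open import Data.Nat.Solver using (module +-*-Solver)
  open +-*-Solver

  Σ-constant-index : ∀ {A : Set} (f : A → ℕ) {c} → (∀ x → f x ≡ c) → (B : ℕ → Set) →
                     Σ A (B ∘ f) ↔ (A × B c)
  Σ-constant-index f f≡c B = mk↔ₛ′
    (λ { (x , b) → x , subst B (f≡c x) b })
    (λ { (x , b) → x , subst B (sym (f≡c x)) b })
    (λ { (x , b) → cong (x ,_) (subst-subst-sym (f≡c x)) })
    (λ { (x , b) → cong (x ,_) (subst-sym-subst (f≡c x)) })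

  Σ-forced-index : ∀ {B : ℕ → Set} {c} → (∀ {v} → B v → v ≡ c) → Σ ℕ B ↔ B c
  Σ-forced-index {B} {c} forced = mk↔ₛ′ to (c ,_) to∘from from∘to
    where
    to : Σ ℕ B → B c
    to (v , b) = subst B (forced b) b
    to∘from : ∀ b → to (c , b) ≡ b
    to∘from b rewrite ℕ.≡-irrelevant (forced b) refl = refl
    from-subst : ∀ {v} (v≡c : v ≡ c) (b : B v) → (c , subst B v≡c b) ≡ (v , b)
    from-subst refl b = refl
    from∘to : ∀ y → (c , to y) ≡ y
    from∘to (v , b) = from-subst (forced b) b

  ×-irrelevant : ∀ {A B : Set} → Irrelevant A → Irrelevant B → Irrelevant (A × B)
  ×-irrelevant A-irr B-irr (a , b) (a′ , b′) = cong₂ _,_ (A-irr a a′) (B-irr b b′)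

  Splits : (ℕ → ℕ → Set) → ℕ → Set
  Splits A n = Σ ℕ λ a → Σ ℕ λ c → (a + c ≡ n) × A a c

  sumSplits : (ℕ → ℕ → ℕ) → ℕ → ℕ
  sumSplits f zero    = f 0 0
  sumSplits f (suc n) = f 0 (suc n) + sumSplits (λ a c → f (suc a) c) n

  Splits-zero : (A : ℕ → ℕ → Set) → A 0 0 ↔ Splits A 0
  Splits-zero A = mk↔ₛ′ (λ x → 0 , 0 , refl , x) from (λ { (0 , 0 , refl , x) → refl }) (λ _ → refl)
    where
    from : Splits A 0 → A 0 0
    from (0 , 0 , refl , x) = x

  Splits-suc : (A : ℕ → ℕ → Set) (n : ℕ) → (A 0 (suc n) ⊎ Splits (λ a c → A (suc a) c) n) ↔ Splits A (suc n)
  Splits-suc A n = mk↔ₛ′ to from to∘from from∘to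
    where
    to : A 0 (suc n) ⊎ Splits (λ a c → A (suc a) c) n → Splits A (suc n)
    to (inj₁ x)                 = 0 , suc n , refl , x
    to (inj₂ (a , c , refl , x)) = suc a , c , refl , x
    from : Splits A (suc n) → A 0 (suc n) ⊎ Splits (λ a c → A (suc a) c) n
    from (zero  , c , refl , x) = inj₁ x
    from (suc a , c , refl , x) = inj₂ (a , c , refl , x)
    to∘from : ∀ y → to (from y) ≡ y
    to∘from (zero  , c , refl , x) = refl
    to∘from (suc a , c , refl , x) = refl
    from∘to : ∀ y → from (to y) ≡ y
    from∘to (inj₁ x)                 = refl
    from∘to (inj₂ (a , c , refl , x)) = refl

  Fin-sumSplits↔Splits : ∀ n (f : ℕ → ℕ → ℕ) (A : ℕ → ℕ → Set) →
                         (∀ a c → a + c ≡ n → Fin (f a c) ↔ A a c) → Fin (sumSplits f n) ↔ Splits A n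
  Fin-sumSplits↔Splits zero    f A f↔A = ↔-trans (f↔A 0 0 refl) (Splits-zero A)
  Fin-sumSplits↔Splits (suc n) f A f↔A = begin
    Fin (f 0 (suc n) + sumSplits (λ a c → f (suc a) c) n)       ↔⟨ +↔⊎ ⟩
    (Fin (f 0 (suc n)) ⊎ Fin (sumSplits (λ a c → f (suc a) c) n)) ↔⟨ f↔A 0 (suc n) refl ⊎-↔ tail ⟩
    (A 0 (suc n) ⊎ Splits (λ a c → A (suc a) c) n)               ↔⟨ Splits-suc A n ⟩
    Splits A (suc n)                                             ∎
    where
    open EquationalReasoning
    tail = Fin-sumSplits↔Splits n (λ a c → f (suc a) c) (λ a c → A (suc a) c) (λ a c e → f↔A (suc a) c (cong suc e))

  Splits-rightZero : (A : ℕ → ℕ → Set) → (∀ a c → ¬ A a (suc c)) → ∀ m → Splits A m ↔ A m 0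
  Splits-rightZero A empty m = mk↔ₛ′ to from to∘from from∘to
    where
    to : Splits A m → A m 0
    to (a , zero  , a+0≡m , x) = subst (λ b → A b 0) (trans (sym (ℕ.+-identityʳ a)) a+0≡m) x
    to (a , suc c , _     , x) = ⊥-elim (empty a c x)
    from : A m 0 → Splits A m
    from y = m , 0 , ℕ.+-identityʳ m , y
    to∘from : ∀ y → to (from y) ≡ y
    to∘from y rewrite ℕ.≡-irrelevant (trans (sym (ℕ.+-identityʳ m)) (ℕ.+-identityʳ m)) refl = refl
    from-subst : ∀ a (a≡m : a ≡ m) (a+0≡m : a + 0 ≡ m) x → from (subst (λ b → A b 0) a≡m x) ≡ (a , 0 , a+0≡m , x)
    from-subst a refl a+0≡m x = cong (λ e → a , 0 , e , x) (ℕ.≡-irrelevant _ _)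
    from∘to : ∀ y → from (to y) ≡ y
    from∘to (a , zero  , a+0≡m , x) = from-subst a _ a+0≡m x
    from∘to (a , suc c , _     , x) = ⊥-elim (empty a c x)

  -- The unique leaf is a visited node, so a traversal starting from 0 visits one node more.
  visitedAfter : ℕ → ℕ → ℕ
  visitedAfter zero    n = suc n
  visitedAfter (suc w) n = suc w + n

  visitedAfter-node : ∀ v n₁ n₂ → suc (visitedAfter (visitedAfter v n₁) n₂) ≡ visitedAfter v (suc (n₁ + n₂))
  visitedAfter-node zero    n₁ n₂ = refl
  visitedAfter-node (suc w) n₁ n₂ = cong suc (cong suc (ℕ.+-assoc w n₁ n₂) ⟨ trans ⟩ sym (ℕ.+-suc w (n₁ + n₂)))

  Rel-visited : ∀ {v n v′} → Rel v n v′ → v′ ≡ visitedAfter v n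
  Rel-visited uleaf                     = refl
  Rel-visited (ptr {w} i)               = sym (ℕ.+-identityʳ (suc w))
  Rel-visited (node {v} {n₁} {_} {n₂} l r) =
    cong suc (Rel-visited r ⟨ trans ⟩ cong (λ u → visitedAfter u n₂) (Rel-visited l)) ⟨ trans ⟩ visitedAfter-node v n₁ n₂

  Tree : ℕ → ℕ → Set
  Tree v n = Σ ℕ (Rel v n)

  Pred : Set₁
  Pred = ∀ {v n v′} → Rel v n v′ → Set

  IrrelevantPred : Pred → Set
  IrrelevantPred R = ∀ {v n v′} (t : Rel v n v′) → Irrelevant (R t)

  Trees : Pred → ℕ → ℕ → Set
  Trees R v n = Σ (Tree v n) λ t → R (proj₂ t)

  module _ {v : ℕ} (R R₁ R₂ : Pred)
           (split : ∀ {n₁ v₁ n₂ v₂} (l : Rel v n₁ v₁) (r : Rel v₁ n₂ v₂) → R (node l r) ⇔ (R₁ l × R₂ r))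
           (R-irr : IrrelevantPred R) (R₁-irr : IrrelevantPred R₁) (R₂-irr : IrrelevantPred R₂) where

    private
      Nodes : ℕ → ℕ → Set
      Nodes a c = Σ (Tree v a) λ l → Σ (Tree (proj₁ l) c) λ r → R (node (proj₂ l) (proj₂ r))

      Trees↔Nodes : ∀ {k} → Trees R v (suc k) ↔ Splits Nodes k
      Trees↔Nodes = mk↔ₛ′ to from to∘from from∘to
        where
        to : ∀ {k} → Trees R v (suc k) → Splits Nodes k
        to ((_ , node {n₁ = a} {v₁} {n₂ = c} {v₂} l r) , p) = a , c , refl , (v₁ , l) , (v₂ , r) , p
        from : ∀ {k} → Splits Nodes k → Trees R v (suc k)
        from (a , c , refl , (v₁ , l) , (v₂ , r) , p) = (suc v₂ , node l r) , p
        to∘from : ∀ {k} (y : Splits Nodes k) → to (from y) ≡ y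
        to∘from (a , c , refl , _ , _ , _) = refl
        from∘to : ∀ {k} (y : Trees R v (suc k)) → from (to y) ≡ y
        from∘to ((_ , node l r) , p) = refl

      Nodes↔Pairs : ∀ a c → Nodes a c ↔ Σ (Trees R₁ v a) λ l → Trees R₂ (proj₁ (proj₁ l)) c
      Nodes↔Pairs a c = mk↔ₛ′
        (λ { (l , r , p) → (l , proj₁ (to (split (proj₂ l) (proj₂ r)) p)) , r , proj₂ (to (split (proj₂ l) (proj₂ r)) p) })
        (λ { ((l , p₁) , r , p₂) → l , r , from (split (proj₂ l) (proj₂ r)) (p₁ , p₂) })
        (λ { ((l , p₁) , r , p₂) →
               cong₂ (λ p₁ p₂ → (l , p₁) , r , p₂) (R₁-irr (proj₂ l) _ _) (R₂-irr (proj₂ r) _ _) })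
        (λ { (l , r , p) → cong (λ p → l , r , p) (R-irr (node (proj₂ l) (proj₂ r)) _ _) })
        where open Equivalence

    Trees-node↔ : ∀ {k} → Trees R v (suc k) ↔ Splits (λ a c → Trees R₁ v a × Trees R₂ (visitedAfter v a) c) k
    Trees-node↔ = ↔-trans Trees↔Nodes (Σ-↔ ↔-refl λ {a} → Σ-↔ ↔-refl λ {c} → Σ-↔ ↔-refl λ {_} →
      ↔-trans (Nodes↔Pairs a c)
              (Σ-constant-index (proj₁ ∘ proj₁) (Rel-visited ∘ proj₂ ∘ proj₁) (λ u → Trees R₂ u c)))

  R5 : Pred
  R5 t = (rightHeight t ≤ 1) × Level0Branch t

  -- A left path: no right edge leads to an internal node.
  LeftPath : Pred
  LeftPath t = leftContribution t ≤ 0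

  -- The admissible right children of a level-0 node.
  NonemptyLeftPath : Pred
  NonemptyLeftPath t = IsNode t × (rightContribution t ≤ 1)

  NonNode : Pred
  NonNode t = rightContribution t ≤ 0

  IsNode-irrelevant : IrrelevantPred IsNode
  IsNode-irrelevant (node _ _) tt tt = refl

  Level0Branch-irrelevant : IrrelevantPred Level0Branch
  Level0Branch-irrelevant uleaf      tt tt = refl
  Level0Branch-irrelevant (ptr _)    tt tt = refl
  Level0Branch-irrelevant (node l r) (r₁ , l₁) (r₂ , l₂) =
    cong₂ _,_ (IsNode-irrelevant r r₁ r₂) (Level0Branch-irrelevant l l₁ l₂)

  R5-irrelevant : IrrelevantPred R5
  R5-irrelevant t = ×-irrelevant ℕ.≤-irrelevant (Level0Branch-irrelevant t)

  LeftPath-irrelevant : IrrelevantPred LeftPath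
  LeftPath-irrelevant t = ℕ.≤-irrelevant

  NonemptyLeftPath-irrelevant : IrrelevantPred NonemptyLeftPath
  NonemptyLeftPath-irrelevant t = ×-irrelevant (IsNode-irrelevant t) ℕ.≤-irrelevant

  NonNode-irrelevant : IrrelevantPred NonNode
  NonNode-irrelevant t = ℕ.≤-irrelevant

  ⊔≤⇔ : ∀ {m n o} → m ⊔ n ≤ o ⇔ (m ≤ o × n ≤ o)
  ⊔≤⇔ {m} {n} = mk⇔ (λ h → ℕ.m⊔n≤o⇒m≤o m n h , ℕ.m⊔n≤o⇒n≤o m n h) (λ (h₁ , h₂) → ℕ.⊔-lub h₁ h₂)

  leftContribution≡rightHeight : ∀ {n v′} (t : Rel 0 n v′) → leftContribution t ≡ rightHeight t
  leftContribution≡rightHeight uleaf      = refl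
  leftContribution≡rightHeight (node l r) = refl

  R5-node⇔ : ∀ {n₁ v₁ n₂ v₂} (l : Rel 0 n₁ v₁) (r : Rel v₁ n₂ v₂) → R5 (node l r) ⇔ (R5 l × NonemptyLeftPath r)
  R5-node⇔ l r = mk⇔
    (λ (h , r-node , l-branch) → let (hl , hr) = Equivalence.to ⊔≤⇔ h
                                 in (subst (_≤ 1) (leftContribution≡rightHeight l) hl , l-branch) , r-node , hr)
    (λ ((hl , l-branch) , r-node , hr) → Equivalence.from ⊔≤⇔ (subst (_≤ 1) (sym (leftContribution≡rightHeight l)) hl , hr)
                                         , r-node , l-branch)

  LeftPath-node⇔ : ∀ {v n₁ v₁ n₂ v₂} (l : Rel v n₁ v₁) (r : Rel v₁ n₂ v₂) →
                   LeftPath (node l r) ⇔ (LeftPath l × NonNode r)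
  LeftPath-node⇔ l r = ⊔≤⇔

  NonemptyLeftPath-node⇔ : ∀ {v n₁ v₁ n₂ v₂} (l : Rel v n₁ v₁) (r : Rel v₁ n₂ v₂) →
                           NonemptyLeftPath (node l r) ⇔ (LeftPath l × NonNode r)
  NonemptyLeftPath-node⇔ l r =
    mk⇔ (λ { (_ , s≤s h) → Equivalence.to ⊔≤⇔ h }) (λ h → tt , s≤s (Equivalence.from ⊔≤⇔ h))

  pointers↔ : (R : Pred) → (∀ {u} (i : Fin (suc u)) → R (ptr i)) → IrrelevantPred R →
              ∀ u → Fin (suc u) ↔ Trees R (suc u) 0
  pointers↔ R R-ptr R-irr u = mk↔ₛ′ (λ i → (suc u , ptr i) , R-ptr i) (λ { ((_ , ptr i) , _) → i })
    (λ { ((_ , ptr i) , p) → cong (λ p → (suc u , ptr i) , p) (R-irr (ptr i) _ _) }) (λ _ → refl)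

  NonNode-suc-empty : ∀ {u k} → ¬ Trees NonNode u (suc k)
  NonNode-suc-empty ((_ , node l r) , ())

  -- w + 1 nodes have been visited when a left path of size m starts.
  leftPathCount : ℕ → ℕ → ℕ
  leftPathCount w zero    = suc w
  leftPathCount w (suc m) = leftPathCount w m * (suc w + m)

  nonemptyLeftPathCount : ℕ → ℕ → ℕ
  nonemptyLeftPathCount w zero    = 0
  nonemptyLeftPathCount w (suc m) = leftPathCount w (suc m)

  LeftPathNodes : ℕ → ℕ → Set
  LeftPathNodes w m = Splits (λ a c → Trees LeftPath (suc w) a × Trees NonNode (suc w + a) c) m

  leftPaths↔ : ∀ w m → Fin (leftPathCount w m) ↔ Trees LeftPath (suc w) m
  leftPathNodes↔ : ∀ w m → Fin (leftPathCount w (suc m)) ↔ LeftPathNodes w m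

  leftPaths↔ w zero    = pointers↔ LeftPath (λ _ → z≤n) LeftPath-irrelevant w
  leftPaths↔ w (suc m) = ↔-trans (leftPathNodes↔ w m)
    (↔-sym (Trees-node↔ LeftPath LeftPath NonNode LeftPath-node⇔ LeftPath-irrelevant LeftPath-irrelevant NonNode-irrelevant))

  leftPathNodes↔ w m = begin
    Fin (leftPathCount w m * (suc w + m))
      ↔⟨ *↔× ⟩
    (Fin (leftPathCount w m) × Fin (suc w + m))
      ↔⟨ leftPaths↔ w m ×-↔ pointers↔ NonNode (λ _ → z≤n) NonNode-irrelevant (w + m) ⟩
    (Trees LeftPath (suc w) m × Trees NonNode (suc w + m) 0)
      ↔⟨ ↔-sym (Splits-rightZero _ (λ _ _ → NonNode-suc-empty ∘ proj₂) m) ⟩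
    LeftPathNodes w m
      ∎
    where open EquationalReasoning

  nonemptyLeftPaths↔ : ∀ w m → Fin (nonemptyLeftPathCount w m) ↔ Trees NonemptyLeftPath (suc w) m
  nonemptyLeftPaths↔ w zero    = mk↔ₛ′ (λ ()) (λ { ((_ , ptr _) , () , _) }) (λ { ((_ , ptr _) , () , _) }) (λ ())
  nonemptyLeftPaths↔ w (suc m) = ↔-trans (leftPathNodes↔ w m)
    (↔-sym (Trees-node↔ NonemptyLeftPath LeftPath NonNode NonemptyLeftPath-node⇔
                        NonemptyLeftPath-irrelevant LeftPath-irrelevant NonNode-irrelevant))

  r5Count : ℕ → ℕ
  r5Count zero                = 1
  r5Count (suc zero)          = 0
  r5Count (suc (suc n))       = suc n * r5Count (suc n) + suc n * suc n * r5Count n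

  sumSplits-cong : ∀ n {f g : ℕ → ℕ → ℕ} → (∀ a c → a + c ≡ n → f a c ≡ g a c) → sumSplits f n ≡ sumSplits g n
  sumSplits-cong zero    f≗g = f≗g 0 0 refl
  sumSplits-cong (suc n) f≗g = cong₂ _+_ (f≗g 0 (suc n) refl) (sumSplits-cong n (λ a c e → f≗g (suc a) c (cong suc e)))

  sumSplits-*ˡ : ∀ n k (f : ℕ → ℕ → ℕ) → sumSplits (λ a c → k * f a c) n ≡ k * sumSplits f n
  sumSplits-*ˡ zero    k f = refl
  sumSplits-*ˡ (suc n) k f = cong (k * f 0 (suc n) +_) (sumSplits-*ˡ n k (λ a c → f (suc a) c))
                             ⟨ trans ⟩ sym (ℕ.*-distribˡ-+ k (f 0 (suc n)) _)

  sumSplits-unsnoc : ∀ (f : ℕ → ℕ → ℕ) n → sumSplits f (suc n) ≡ sumSplits (λ a c → f a (suc c)) n + f (suc n) 0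
  sumSplits-unsnoc f zero    = refl
  sumSplits-unsnoc f (suc n) = cong (f 0 (suc (suc n)) +_) (sumSplits-unsnoc (λ a c → f (suc a) c) n)
                               ⟨ trans ⟩ sym (ℕ.+-assoc (f 0 (suc (suc n))) _ _)

  rootSplitCount pathSplitCount : ℕ → ℕ
  rootSplitCount = sumSplits (λ a c → r5Count a * nonemptyLeftPathCount a c)
  pathSplitCount  = sumSplits (λ a c → r5Count a * leftPathCount a c)

  private
    shiftedPathSplitCount : ℕ → ℕ
    shiftedPathSplitCount = sumSplits (λ a c → r5Count a * leftPathCount a (suc c))

    rootSplitCount-unsnoc : ∀ m → rootSplitCount (suc m) ≡ shiftedPathSplitCount m
    rootSplitCount-unsnoc m =
      sumSplits-unsnoc (λ a c → r5Count a * nonemptyLeftPathCount a c) m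
      ⟨ trans ⟩ cong (shiftedPathSplitCount m +_) (ℕ.*-zeroʳ (r5Count (suc m)))
      ⟨ trans ⟩ ℕ.+-identityʳ (shiftedPathSplitCount m)

  rootSplitCount-suc : ∀ m → rootSplitCount (suc m) ≡ suc m * pathSplitCount m
  rootSplitCount-suc m = rootSplitCount-unsnoc m ⟨ trans ⟩ sumSplits-cong m term ⟨ trans ⟩ sumSplits-*ˡ m (suc m) _
    where
    term : ∀ a c → a + c ≡ m → r5Count a * (leftPathCount a c * (suc a + c)) ≡ suc m * (r5Count a * leftPathCount a c)
    term a c refl = solve 3 (λ x y z → x :* (y :* z) := z :* (x :* y)) refl (r5Count a) (leftPathCount a c) (suc (a + c))

  pathSplitCount-suc : ∀ m → pathSplitCount (suc m) ≡ rootSplitCount (suc m) + r5Count (suc m) * suc (suc m)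
  pathSplitCount-suc m = sumSplits-unsnoc (λ a c → r5Count a * leftPathCount a c) m
                         ⟨ trans ⟩ cong (_+ r5Count (suc m) * suc (suc m)) (sym (rootSplitCount-unsnoc m))

  r5Count-suc : ∀ k → r5Count (suc k) ≡ rootSplitCount k
  r5Count-suc zero          = refl
  r5Count-suc (suc zero)    = refl
  r5Count-suc (suc (suc m)) = sym (begin
    rootSplitCount (suc (suc m))
      ≡⟨ rootSplitCount-suc (suc m) ⟩
    k * pathSplitCount (suc m)
      ≡⟨ cong (k *_) (pathSplitCount-suc m) ⟩
    k * (rootSplitCount (suc m) + r5Count (suc m) * k)
      ≡⟨ cong (λ x → k * (x + r5Count (suc m) * k)) (r5Count-suc (suc m)) ⟨
    k * (r5Count (suc (suc m)) + r5Count (suc m) * k)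
      ≡⟨ solve 3 (λ k x y → k :* (x :+ y :* k) := k :* x :+ k :* k :* y) refl k (r5Count (suc (suc m))) (r5Count (suc m)) ⟩
    r5Count (suc (suc (suc m)))
      ∎)
    where
    open ≡-Reasoning
    k = suc (suc m)

  singleLeaf↔ : Trees R5 0 0 ↔ ⊤
  singleLeaf↔ = mk↔ₛ′ (λ _ → tt) (λ _ → (1 , uleaf) , z≤n , tt) (λ _ → refl)
    (λ { ((_ , uleaf) , p) → cong (λ p → (1 , uleaf) , p) (R5-irrelevant uleaf _ _) })

  r5Trees↔ : ∀ n → Fin (r5Count n) ↔ Trees R5 0 n
  r5Trees↔ = <-rec (λ n → Fin (r5Count n) ↔ Trees R5 0 n) step
    where
    open EquationalReasoning
    a<suc-k : ∀ {a c k} → a + c ≡ k → a < suc k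
    a<suc-k {a} a+c≡k = s≤s (ℕ.m+n≤o⇒m≤o a (ℕ.≤-reflexive a+c≡k))
    step : ∀ n → (∀ {m} → m < n → Fin (r5Count m) ↔ Trees R5 0 m) → Fin (r5Count n) ↔ Trees R5 0 n
    step zero    _   = ↔-trans 1↔⊤ (↔-sym singleLeaf↔)
    step (suc k) rec = begin
      Fin (r5Count (suc k))
        ≡⟨ cong Fin (r5Count-suc k) ⟩
      Fin (rootSplitCount k)
        ↔⟨ Fin-sumSplits↔Splits k _ _ (λ a c a+c≡k → ↔-trans *↔× (rec (a<suc-k a+c≡k) ×-↔ nonemptyLeftPaths↔ a c)) ⟩
      Splits (λ a c → Trees R5 0 a × Trees NonemptyLeftPath (suc a) c) k
        ↔⟨ ↔-sym (Trees-node↔ R5 R5 NonemptyLeftPath R5-node⇔ R5-irrelevant R5-irrelevant NonemptyLeftPath-irrelevant) ⟩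
      Trees R5 0 (suc k)
        ∎

  Trees↔R5Tree : ∀ n → Trees R5 0 n ↔ R5Tree n
  Trees↔R5Tree n = ↔-trans Σ-assoc (Σ-forced-index (Rel-visited ∘ proj₁))

  Fin-r5Count↔R5Tree : ∀ n → Fin (r5Count n) ↔ R5Tree n
  Fin-r5Count↔R5Tree n = ↔-trans (r5Trees↔ n) (Trees↔R5Tree n)

module ExponentialFormula where

  open import Data.Nat as ℕ using (ℕ; zero; suc; _∸_; _≤_; _<_; z≤n; s≤s; _!)
  import Data.Nat.Properties as ℕ
  open import Data.Integer as ℤ using (+_)
  import Data.Integer.Properties as ℤ
  open import Data.Nat.Coprimality as Coprime using (1-coprimeTo)
  open import Data.Rational as ℚ using (ℚ; mkℚ; _+_; _*_; 0ℚ; 1ℚ; _/_)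
  open import Data.Rational.Properties
  open import Data.Rational.Solver using (module +-*-Solver)
  open import Relation.Binary.PropositionalEquality
  open import Function.Base using (_⟨_⟩_)
  open import Algebra.Bundles using (CommutativeMonoid)
  open import Algebra.Properties.CommutativeSemigroup (CommutativeMonoid.commutativeSemigroup +-0-commutativeMonoid)
    using () renaming (interchange to +-interchange)
  open +-*-Solver
  open ≡-Reasoning

  *-left-commute : ∀ a b c → a * (b * c) ≡ b * (a * c)
  *-left-commute = solve 3 (λ a b c → a :* (b :* c) := b :* (a :* c)) refl

  ℕtoℚ≡mkℚ : ∀ m → ℕtoℚ m ≡ mkℚ (+ m) 0 (Coprime.sym (1-coprimeTo m))
  ℕtoℚ≡mkℚ m = normalize-coprime (Coprime.sym (1-coprimeTo m))

  ℕtoℚ-homo-+ : ∀ m n → ℕtoℚ (m ℕ.+ n) ≡ ℕtoℚ m + ℕtoℚ n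
  ℕtoℚ-homo-+ m n = begin
    + (m ℕ.+ n) / 1
      ≡⟨ /-cong (cong₂ ℤ._+_ (sym (ℤ.*-identityʳ (+ m))) (sym (ℤ.*-identityʳ (+ n)))) refl ⟩
    (+ m ℤ.* + 1 ℤ.+ + n ℤ.* + 1) / 1
      ≡⟨ cong₂ _+_ (ℕtoℚ≡mkℚ m) (ℕtoℚ≡mkℚ n) ⟨
    ℕtoℚ m + ℕtoℚ n
      ∎

  ℕtoℚ-homo-* : ∀ m n → ℕtoℚ (m ℕ.* n) ≡ ℕtoℚ m * ℕtoℚ n
  ℕtoℚ-homo-* m n = begin
    + (m ℕ.* n) / 1        ≡⟨ /-cong (ℤ.pos-* m n) refl ⟩
    (+ m ℤ.* + n) / 1      ≡⟨ cong₂ _*_ (ℕtoℚ≡mkℚ m) (ℕtoℚ≡mkℚ n) ⟨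
    ℕtoℚ m * ℕtoℚ n        ∎

  ℕtoℚ-*-inverse : ∀ d .{{_ : ℕ.NonZero d}} → ℕtoℚ d * (+ 1 / d) ≡ 1ℚ
  ℕtoℚ-*-inverse (suc d) = begin
    ℕtoℚ (suc d) * (+ 1 / suc d)  ≡⟨ cong₂ _*_ (ℕtoℚ≡mkℚ (suc d)) (normalize-coprime (1-coprimeTo (suc d))) ⟩
    m * ℚ.1/ m                    ≡⟨ *-inverseʳ m ⟩
    1ℚ                            ∎
    where m = mkℚ (+ suc d) 0 (Coprime.sym (1-coprimeTo (suc d)))

  ℕtoℚ-suc-*-inv! : ∀ k → ℕtoℚ (suc k) * inv! (suc k) ≡ inv! k
  ℕtoℚ-suc-*-inv! k = begin
    s * i₁                    ≡⟨ *-identityʳ (s * i₁) ⟨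
    s * i₁ * 1ℚ               ≡⟨ cong (s * i₁ *_) (ℕtoℚ-*-inverse (k !) {{k ℕ.!≢0}}) ⟨
    s * i₁ * (f * i₀)         ≡⟨ solve 4 (λ s i₁ f i₀ → s :* i₁ :* (f :* i₀) := s :* f :* i₁ :* i₀) refl s i₁ f i₀ ⟩
    (s * f) * i₁ * i₀         ≡⟨ cong (λ x → x * i₁ * i₀) (ℕtoℚ-homo-* (suc k) (k !)) ⟨
    ℕtoℚ (suc k !) * i₁ * i₀  ≡⟨ cong (_* i₀) (ℕtoℚ-*-inverse (suc k !) {{suc k ℕ.!≢0}}) ⟩
    1ℚ * i₀                   ≡⟨ *-identityˡ i₀ ⟩
    i₀                        ∎
    where s = ℕtoℚ (suc k); i₁ = inv! (suc k); f = ℕtoℚ (k !); i₀ = inv! k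

  sumTo-cong : ∀ n {f g : ℕ → ℚ} → (∀ i → i ≤ n → f i ≡ g i) → sumTo n f ≡ sumTo n g
  sumTo-cong zero    f≗g = f≗g 0 z≤n
  sumTo-cong (suc n) f≗g = cong₂ _+_ (sumTo-cong n (λ i i≤n → f≗g i (ℕ.m≤n⇒m≤1+n i≤n))) (f≗g (suc n) ℕ.≤-refl)

  sumTo-cong′ : ∀ n {f g : ℕ → ℚ} → (∀ i → f i ≡ g i) → sumTo n f ≡ sumTo n g
  sumTo-cong′ n f≗g = sumTo-cong n (λ i _ → f≗g i)

  sumTo-zero : ∀ n {f : ℕ → ℚ} → (∀ i → i ≤ n → f i ≡ 0ℚ) → sumTo n f ≡ 0ℚ
  sumTo-zero n f≗0 = sumTo-cong n f≗0 ⟨ trans ⟩ sumTo-const0 n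
    where
    sumTo-const0 : ∀ n → sumTo n (λ _ → 0ℚ) ≡ 0ℚ
    sumTo-const0 zero    = refl
    sumTo-const0 (suc n) = cong (_+ 0ℚ) (sumTo-const0 n)

  sumTo-+ : ∀ n (f g : ℕ → ℚ) → sumTo n (λ i → f i + g i) ≡ sumTo n f + sumTo n g
  sumTo-+ zero    f g = refl
  sumTo-+ (suc n) f g = begin
    sumTo n (λ i → f i + g i) + (f (suc n) + g (suc n))  ≡⟨ cong (_+ (f (suc n) + g (suc n))) (sumTo-+ n f g) ⟩
    (sumTo n f + sumTo n g) + (f (suc n) + g (suc n))    ≡⟨ +-interchange (sumTo n f) (sumTo n g) (f (suc n)) (g (suc n)) ⟩
    sumTo (suc n) f + sumTo (suc n) g                    ∎

  sumTo-*ˡ : ∀ n c (f : ℕ → ℚ) → sumTo n (λ i → c * f i) ≡ c * sumTo n f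
  sumTo-*ˡ zero    c f = refl
  sumTo-*ˡ (suc n) c f = cong (_+ c * f (suc n)) (sumTo-*ˡ n c f) ⟨ trans ⟩ sym (*-distribˡ-+ c _ _)

  sumTo-*ʳ : ∀ n c (f : ℕ → ℚ) → sumTo n (λ i → f i * c) ≡ sumTo n f * c
  sumTo-*ʳ n c f = sumTo-cong′ n (λ i → *-comm (f i) c) ⟨ trans ⟩ sumTo-*ˡ n c f ⟨ trans ⟩ *-comm c _

  sumTo-unconsˡ : ∀ n (f : ℕ → ℚ) → sumTo (suc n) f ≡ f 0 + sumTo n (λ i → f (suc i))
  sumTo-unconsˡ zero    f = refl
  sumTo-unconsˡ (suc n) f = cong (_+ f (suc (suc n))) (sumTo-unconsˡ n f) ⟨ trans ⟩ +-assoc (f 0) _ _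

  sumTo-reverse : ∀ n (f : ℕ → ℚ) → sumTo n f ≡ sumTo n (λ i → f (n ∸ i))
  sumTo-reverse zero    f = refl
  sumTo-reverse (suc n) f = begin
    sumTo n f + f (suc n)                           ≡⟨ cong (_+ f (suc n)) (sumTo-reverse n f) ⟩
    sumTo n (λ i → f (n ∸ i)) + f (suc n)           ≡⟨ +-comm _ (f (suc n)) ⟩
    f (suc n) + sumTo n (λ i → f (suc n ∸ suc i))   ≡⟨ sumTo-unconsˡ n (λ i → f (suc n ∸ i)) ⟨
    sumTo (suc n) (λ i → f (suc n ∸ i))             ∎

  sumTo-comm : ∀ m n (x : ℕ → ℕ → ℚ) → sumTo m (λ i → sumTo n (x i)) ≡ sumTo n (λ j → sumTo m (λ i → x i j))
  sumTo-comm zero    n x = refl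
  sumTo-comm (suc m) n x = cong (_+ sumTo n (x (suc m))) (sumTo-comm m n x)
                           ⟨ trans ⟩ sym (sumTo-+ n (λ j → sumTo m (λ i → x i j)) (x (suc m)))

  antidiagonalSum : ℕ → (ℕ → ℕ → ℚ) → ℚ
  antidiagonalSum m x = sumTo m (λ i → x i (m ∸ i))

  antidiagonalSum-flip : ∀ m x → antidiagonalSum m x ≡ antidiagonalSum m (λ i j → x j i)
  antidiagonalSum-flip m x = sumTo-reverse m (λ i → x i (m ∸ i))
                             ⟨ trans ⟩ sumTo-cong m (λ i i≤m → cong (x (m ∸ i)) (ℕ.m∸[m∸n]≡n i≤m))

  triangleSum : ℕ → (ℕ → ℕ → ℚ) → ℚ
  triangleSum n x = sumTo n (λ i → sumTo (n ∸ i) (x i))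

  triangleSum-cong : ∀ n {x y : ℕ → ℕ → ℚ} → (∀ i j → x i j ≡ y i j) → triangleSum n x ≡ triangleSum n y
  triangleSum-cong n x≗y = sumTo-cong′ n (λ i → sumTo-cong′ (n ∸ i) (x≗y i))

  triangleSum-byAntidiagonals : ∀ n x → triangleSum n x ≡ sumTo n (λ m → antidiagonalSum m x)
  triangleSum-byAntidiagonals zero    x = refl
  triangleSum-byAntidiagonals (suc n) x = begin
    sumTo n (λ i → sumTo (suc n ∸ i) (x i)) + sumTo (suc n ∸ suc n) (x (suc n))
      ≡⟨ cong₂ _+_ (sumTo-cong n (λ i → sumTo-suc∸ (x i))) (cong (λ k → sumTo k (x (suc n))) (ℕ.n∸n≡0 n)) ⟩
    sumTo n (λ i → sumTo (n ∸ i) (x i) + x i (suc n ∸ i)) + x (suc n) 0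
      ≡⟨ cong (_+ x (suc n) 0) (sumTo-+ n (λ i → sumTo (n ∸ i) (x i)) (λ i → x i (suc n ∸ i))) ⟩
    (triangleSum n x + sumTo n (λ i → x i (suc n ∸ i))) + x (suc n) 0
      ≡⟨ +-assoc (triangleSum n x) _ _ ⟩
    triangleSum n x + (sumTo n (λ i → x i (suc n ∸ i)) + x (suc n) 0)
      ≡⟨ cong₂ _+_ (triangleSum-byAntidiagonals n x)
                   (cong (λ k → sumTo n (λ i → x i (suc n ∸ i)) + x (suc n) k) (sym (ℕ.n∸n≡0 n))) ⟩
    sumTo n (λ m → antidiagonalSum m x) + antidiagonalSum (suc n) x
      ∎
    where
    sumTo-suc∸ : ∀ {i} f → i ≤ n → sumTo (suc n ∸ i) f ≡ sumTo (n ∸ i) f + f (suc n ∸ i)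
    sumTo-suc∸ f i≤n rewrite ℕ.+-∸-assoc 1 i≤n = refl

  triangleSum-flip : ∀ n x → triangleSum n x ≡ triangleSum n (λ i j → x j i)
  triangleSum-flip n x = begin
    triangleSum n x                                       ≡⟨ triangleSum-byAntidiagonals n x ⟩
    sumTo n (λ m → antidiagonalSum m x)                   ≡⟨ sumTo-cong′ n (λ m → antidiagonalSum-flip m x) ⟩
    sumTo n (λ m → antidiagonalSum m (λ i j → x j i))     ≡⟨ triangleSum-byAntidiagonals n (λ i j → x j i) ⟨
    triangleSum n (λ i j → x j i)                         ∎

  ⋆-congˡ : ∀ {f f′ : Series} (g : Series) n → (∀ m → f m ≡ f′ m) → (f ⋆ g) n ≡ (f′ ⋆ g) n
  ⋆-congˡ g n f≗f′ = sumTo-cong′ n (λ i → cong (_* g (n ∸ i)) (f≗f′ i))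

  ⋆-congʳ : ∀ (f : Series) {g g′ : Series} n → (∀ m → g m ≡ g′ m) → (f ⋆ g) n ≡ (f ⋆ g′) n
  ⋆-congʳ f n g≗g′ = sumTo-cong′ n (λ i → cong (f i *_) (g≗g′ (n ∸ i)))

  ⋆-comm : ∀ f g n → (f ⋆ g) n ≡ (g ⋆ f) n
  ⋆-comm f g n = antidiagonalSum-flip n (λ i j → f i * g j) ⟨ trans ⟩ sumTo-cong′ n (λ i → *-comm (f (n ∸ i)) (g i))

  ⋆-assoc : ∀ f g h n → (f ⋆ (g ⋆ h)) n ≡ ((f ⋆ g) ⋆ h) n
  ⋆-assoc f g h n = begin
    (f ⋆ (g ⋆ h)) n
      ≡⟨ ⋆-congʳ f n (⋆-comm g h) ⟩
    (f ⋆ (h ⋆ g)) n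
      ≡⟨ sumTo-cong′ n (λ i → sumTo-*ˡ (n ∸ i) (f i) (λ j → h j * g (n ∸ i ∸ j))) ⟨
    triangleSum n (λ i j → f i * (h j * g (n ∸ i ∸ j)))
      ≡⟨ triangleSum-flip n _ ⟩
    triangleSum n (λ j i → f i * (h j * g (n ∸ i ∸ j)))
      ≡⟨ triangleSum-cong n (λ j i → cong (λ k → f i * (h j * g k)) (∸-∸-comm n i j)) ⟩
    triangleSum n (λ j i → f i * (h j * g (n ∸ j ∸ i)))
      ≡⟨ triangleSum-cong n (λ j i → *-left-commute (f i) (h j) (g (n ∸ j ∸ i))) ⟩
    triangleSum n (λ j i → h j * (f i * g (n ∸ j ∸ i)))
      ≡⟨ sumTo-cong′ n (λ j → sumTo-*ˡ (n ∸ j) (h j) (λ i → f i * g (n ∸ j ∸ i))) ⟩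
    (h ⋆ (f ⋆ g)) n
      ≡⟨ ⋆-comm h (f ⋆ g) n ⟩
    ((f ⋆ g) ⋆ h) n
      ∎
    where
    ∸-∸-comm : ∀ n i j → n ∸ i ∸ j ≡ n ∸ j ∸ i
    ∸-∸-comm n i j = ℕ.∸-+-assoc n i j ⟨ trans ⟩ cong (n ∸_) (ℕ.+-comm i j) ⟨ trans ⟩ sym (ℕ.∸-+-assoc n j i)

  ⋆-left-commute : ∀ f g h n → (f ⋆ (g ⋆ h)) n ≡ (g ⋆ (f ⋆ h)) n
  ⋆-left-commute f g h n = ⋆-assoc f g h n ⟨ trans ⟩ ⋆-congˡ h n (⋆-comm f g) ⟨ trans ⟩ sym (⋆-assoc g f h n)

  ⋆-identityˡ : ∀ f n → (oneS ⋆ f) n ≡ f n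
  ⋆-identityˡ f zero    = *-identityˡ (f 0)
  ⋆-identityˡ f (suc n) = begin
    (oneS ⋆ f) (suc n)
      ≡⟨ sumTo-unconsˡ n (λ i → oneS i * f (suc n ∸ i)) ⟩
    1ℚ * f (suc n) + sumTo n (λ i → 0ℚ * f (n ∸ i))
      ≡⟨ cong₂ _+_ (*-identityˡ (f (suc n))) (sumTo-zero n (λ i _ → *-zeroˡ (f (n ∸ i)))) ⟩
    f (suc n) + 0ℚ
      ≡⟨ +-identityʳ (f (suc n)) ⟩
    f (suc n)
      ∎

  ⋆-zeroʳ : ∀ f {g : Series} n → (∀ m → g m ≡ 0ℚ) → (f ⋆ g) n ≡ 0ℚ
  ⋆-zeroʳ f n g≗0 = sumTo-zero n (λ i _ → cong (f i *_) (g≗0 (n ∸ i)) ⟨ trans ⟩ *-zeroʳ (f i))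

  ⋆-distribʳ-+ : ∀ f g h n → ((λ i → f i + g i) ⋆ h) n ≡ (f ⋆ h) n + (g ⋆ h) n
  ⋆-distribʳ-+ f g h n = sumTo-cong′ n (λ i → *-distribʳ-+ (h (n ∸ i)) (f i) (g i))
                         ⟨ trans ⟩ sumTo-+ n (λ i → f i * h (n ∸ i)) (λ i → g i * h (n ∸ i))

  ⋆-scaleʳ : ∀ f (g : Series) c n → (f ⋆ (λ m → c * g m)) n ≡ c * (f ⋆ g) n
  ⋆-scaleʳ f g c n = sumTo-cong′ n (λ i → *-left-commute (f i) c (g (n ∸ i))) ⟨ trans ⟩ sumTo-*ˡ n c _

  ⋆-shiftˡ : ∀ f g n → f 0 ≡ 0ℚ → (f ⋆ g) (suc n) ≡ ((λ i → f (suc i)) ⋆ g) n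
  ⋆-shiftˡ f g n f₀≡0 = begin
    (f ⋆ g) (suc n)                                  ≡⟨ sumTo-unconsˡ n (λ i → f i * g (suc n ∸ i)) ⟩
    f 0 * g (suc n) + ((λ i → f (suc i)) ⋆ g) n      ≡⟨ cong (λ a → a * g (suc n) + ((λ i → f (suc i)) ⋆ g) n) f₀≡0 ⟩
    0ℚ * g (suc n) + ((λ i → f (suc i)) ⋆ g) n       ≡⟨ cong (_+ ((λ i → f (suc i)) ⋆ g) n) (*-zeroˡ (g (suc n))) ⟩
    0ℚ + ((λ i → f (suc i)) ⋆ g) n                   ≡⟨ +-identityˡ _ ⟩
    ((λ i → f (suc i)) ⋆ g) n                        ∎

  θ : Series → Series
  θ f n = ℕtoℚ n * f n

  θ-zero : ∀ f → θ f 0 ≡ 0ℚ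
  θ-zero f = *-zeroˡ (f 0)

  θ-zero-* : ∀ f y → θ f 0 * y ≡ 0ℚ
  θ-zero-* f y = trans (cong (_* y) (θ-zero f)) (*-zeroˡ y)

  θ-oneS : ∀ n → θ oneS n ≡ 0ℚ
  θ-oneS zero    = *-zeroˡ 1ℚ
  θ-oneS (suc n) = *-zeroʳ (ℕtoℚ (suc n))

  θ-⋆ : ∀ f g n → θ (f ⋆ g) n ≡ (θ f ⋆ g) n + (f ⋆ θ g) n
  θ-⋆ f g n = sym (sumTo-*ˡ n (ℕtoℚ n) _) ⟨ trans ⟩ sumTo-cong n leibniz ⟨ trans ⟩ sumTo-+ n _ _
    where
    leibniz : ∀ i → i ≤ n → ℕtoℚ n * (f i * g (n ∸ i)) ≡ θ f i * g (n ∸ i) + f i * θ g (n ∸ i)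
    leibniz i i≤n = begin
      ℕtoℚ n * (f i * g (n ∸ i))
        ≡⟨ cong (λ k → ℕtoℚ k * (f i * g (n ∸ i))) (ℕ.m+[n∸m]≡n i≤n) ⟨
      ℕtoℚ (i ℕ.+ (n ∸ i)) * (f i * g (n ∸ i))
        ≡⟨ cong (_* (f i * g (n ∸ i))) (ℕtoℚ-homo-+ i (n ∸ i)) ⟩
      (ℕtoℚ i + ℕtoℚ (n ∸ i)) * (f i * g (n ∸ i))
        ≡⟨ solve 4 (λ a b x y → (a :+ b) :* (x :* y) := (a :* x) :* y :+ x :* (b :* y)) refl
                   (ℕtoℚ i) (ℕtoℚ (n ∸ i)) (f i) (g (n ∸ i)) ⟩
      θ f i * g (n ∸ i) + f i * θ g (n ∸ i)
        ∎

  θ-^S : ∀ G k n → θ (G ^S suc k) n ≡ ℕtoℚ (suc k) * (θ G ⋆ (G ^S k)) n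
  θ-^S G zero n = begin
    θ (G ⋆ oneS) n                           ≡⟨ θ-⋆ G oneS n ⟩
    (θ G ⋆ oneS) n + (G ⋆ θ oneS) n          ≡⟨ cong (_+_ ((θ G ⋆ oneS) n)) (⋆-zeroʳ G n θ-oneS) ⟩
    (θ G ⋆ oneS) n + 0ℚ                      ≡⟨ +-identityʳ _ ⟩
    (θ G ⋆ oneS) n                           ≡⟨ *-identityˡ _ ⟨
    1ℚ * (θ G ⋆ oneS) n                      ∎
  θ-^S G (suc k) n = begin
    θ (G ⋆ (G ^S suc k)) n
      ≡⟨ θ-⋆ G (G ^S suc k) n ⟩
    X + (G ⋆ θ (G ^S suc k)) n
      ≡⟨ cong (_+_ X) (⋆-congʳ G n (θ-^S G k)) ⟩
    X + (G ⋆ (λ m → ℕtoℚ (suc k) * (θ G ⋆ (G ^S k)) m)) n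
      ≡⟨ cong (_+_ X) (⋆-scaleʳ G (θ G ⋆ (G ^S k)) (ℕtoℚ (suc k)) n) ⟩
    X + ℕtoℚ (suc k) * (G ⋆ (θ G ⋆ (G ^S k))) n
      ≡⟨ cong (λ y → X + ℕtoℚ (suc k) * y) (⋆-left-commute G (θ G) (G ^S k) n) ⟩
    X + ℕtoℚ (suc k) * X
      ≡⟨ solve 2 (λ x c → x :+ c :* x := (con 1ℚ :+ c) :* x) refl X (ℕtoℚ (suc k)) ⟩
    (1ℚ + ℕtoℚ (suc k)) * X
      ≡⟨ cong (_* X) (ℕtoℚ-homo-+ 1 (suc k)) ⟨
    ℕtoℚ (suc (suc k)) * X
      ∎
    where X = (θ G ⋆ (G ^S suc k)) n

  module _ (G : Series) (G₀≡0 : G 0 ≡ 0ℚ) where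

    ^S-vanishes-below : ∀ k m → m < k → (G ^S k) m ≡ 0ℚ
    ^S-vanishes-below (suc k) m (s≤s m≤k) = sumTo-zero m term≡0
      where
      term≡0 : ∀ i → i ≤ m → G i * (G ^S k) (m ∸ i) ≡ 0ℚ
      term≡0 zero    _   = cong (_* (G ^S k) m) G₀≡0 ⟨ trans ⟩ *-zeroˡ ((G ^S k) m)
      term≡0 (suc i) i<m = cong (G (suc i) *_) (^S-vanishes-below k (m ∸ suc i) m-i-1<k) ⟨ trans ⟩ *-zeroʳ (G (suc i))
        where m-i-1<k = ℕ.<-≤-trans (ℕ.∸-monoʳ-< {o = 0} (s≤s z≤n) i<m) m≤k

    expS-extend : ∀ d n → sumTo (d ℕ.+ n) (λ k → (G ^S k) n * inv! k) ≡ expS G n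
    expS-extend zero    n = refl
    expS-extend (suc d) n = begin
      sumTo N term + (G ^S suc N) n * inv! (suc N)
        ≡⟨ cong (λ x → sumTo N term + x * inv! (suc N)) (^S-vanishes-below (suc N) n (s≤s (ℕ.m≤n+m n d))) ⟩
      sumTo N term + 0ℚ * inv! (suc N)
        ≡⟨ cong (_+_ (sumTo N term)) (*-zeroˡ (inv! (suc N))) ⟩
      sumTo N term + 0ℚ
        ≡⟨ +-identityʳ (sumTo N term) ⟩
      sumTo N term
        ≡⟨ expS-extend d n ⟩
      expS G n
        ∎
      where
      N = d ℕ.+ n
      term = λ k → (G ^S k) n * inv! k

    -- Termwise: θ (G^{k+1}) / (k+1)! = θG · G^k / k!.
    θ-expS : ∀ n → θ (expS G) n ≡ (θ G ⋆ expS G) n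
    θ-expS zero    = trans (θ-zero (expS G)) (sym (θ-zero-* G (expS G 0)))
    θ-expS (suc m) = begin
      ℕtoℚ (suc m) * sumTo (suc m) (λ k → (G ^S k) (suc m) * inv! k)
        ≡⟨ sumTo-*ˡ (suc m) (ℕtoℚ (suc m)) _ ⟨
      sumTo (suc m) (λ k → ℕtoℚ (suc m) * ((G ^S k) (suc m) * inv! k))
        ≡⟨ sumTo-cong′ (suc m) (λ k → sym (*-assoc (ℕtoℚ (suc m)) ((G ^S k) (suc m)) (inv! k))) ⟩
      sumTo (suc m) (λ k → θ (G ^S k) (suc m) * inv! k)
        ≡⟨ sumTo-unconsˡ m (λ k → θ (G ^S k) (suc m) * inv! k) ⟩
      θ oneS (suc m) * inv! 0 + sumTo m (λ k → θ (G ^S suc k) (suc m) * inv! (suc k))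
        ≡⟨ cong (λ x → x * inv! 0 + derivatives) (θ-oneS (suc m)) ⟩
      0ℚ * inv! 0 + derivatives
        ≡⟨ cong (_+ derivatives) (*-zeroˡ (inv! 0)) ⟩
      0ℚ + derivatives
        ≡⟨ +-identityˡ derivatives ⟩
      sumTo m (λ k → θ (G ^S suc k) (suc m) * inv! (suc k))
        ≡⟨ sumTo-cong′ m differentiate-power ⟩
      sumTo m (λ k → sumTo (suc m) (λ i → θ G i * ((G ^S k) (suc m ∸ i) * inv! k)))
        ≡⟨ sumTo-comm m (suc m) (λ k i → θ G i * ((G ^S k) (suc m ∸ i) * inv! k)) ⟩
      sumTo (suc m) (λ i → sumTo m (λ k → θ G i * ((G ^S k) (suc m ∸ i) * inv! k)))
        ≡⟨ sumTo-cong′ (suc m) (λ i → sumTo-*ˡ m (θ G i) (λ k → (G ^S k) (suc m ∸ i) * inv! k)) ⟩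
      sumTo (suc m) (λ i → θ G i * sumTo m (λ k → (G ^S k) (suc m ∸ i) * inv! k))
        ≡⟨ sumTo-cong (suc m) truncate ⟩
      (θ G ⋆ expS G) (suc m)
        ∎
      where
      derivatives = sumTo m (λ k → θ (G ^S suc k) (suc m) * inv! (suc k))
      differentiate-power : ∀ k → θ (G ^S suc k) (suc m) * inv! (suc k)
                                   ≡ sumTo (suc m) (λ i → θ G i * ((G ^S k) (suc m ∸ i) * inv! k))
      differentiate-power k = begin
        θ (G ^S suc k) (suc m) * inv! (suc k)
          ≡⟨ cong (_* inv! (suc k)) (θ-^S G k (suc m)) ⟩
        ℕtoℚ (suc k) * (θ G ⋆ (G ^S k)) (suc m) * inv! (suc k)
          ≡⟨ solve 3 (λ c x y → c :* x :* y := x :* (c :* y)) refl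
              (ℕtoℚ (suc k)) ((θ G ⋆ (G ^S k)) (suc m)) (inv! (suc k)) ⟩
        (θ G ⋆ (G ^S k)) (suc m) * (ℕtoℚ (suc k) * inv! (suc k))
          ≡⟨ cong ((θ G ⋆ (G ^S k)) (suc m) *_) (ℕtoℚ-suc-*-inv! k) ⟩
        (θ G ⋆ (G ^S k)) (suc m) * inv! k
          ≡⟨ sumTo-*ʳ (suc m) (inv! k) (λ i → θ G i * (G ^S k) (suc m ∸ i)) ⟨
        sumTo (suc m) (λ i → θ G i * (G ^S k) (suc m ∸ i) * inv! k)
          ≡⟨ sumTo-cong′ (suc m) (λ i → *-assoc (θ G i) _ (inv! k)) ⟩
        sumTo (suc m) (λ i → θ G i * ((G ^S k) (suc m ∸ i) * inv! k))
          ∎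
      truncate : ∀ i → i ≤ suc m →
                 θ G i * sumTo m (λ k → (G ^S k) (suc m ∸ i) * inv! k) ≡ θ G i * expS G (suc m ∸ i)
      truncate zero    _         = trans (θ-zero-* G _) (sym (θ-zero-* G _))
      truncate (suc i) (s≤s i≤m) = cong (θ G (suc i) *_)
        (cong (λ b → sumTo b (λ k → (G ^S k) (m ∸ i) * inv! k)) (sym (ℕ.m+[n∸m]≡n i≤m))
         ⟨ trans ⟩ expS-extend i (m ∸ i))

  θ-fibLogSeries : ∀ n → θ fibLogSeries (suc n) ≡ ℕtoℚ (fib n)
  θ-fibLogSeries n = begin
    ℕtoℚ (suc n) * (+ fib n / suc n)
      ≡⟨ cong (ℕtoℚ (suc n) *_) fraction ⟩
    ℕtoℚ (suc n) * (ℕtoℚ (fib n) * (+ 1 / suc n))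
      ≡⟨ solve 3 (λ s a i → s :* (a :* i) := a :* (s :* i)) refl
          (ℕtoℚ (suc n)) (ℕtoℚ (fib n)) (+ 1 / suc n) ⟩
    ℕtoℚ (fib n) * (ℕtoℚ (suc n) * (+ 1 / suc n))
      ≡⟨ cong (ℕtoℚ (fib n) *_) (ℕtoℚ-*-inverse (suc n)) ⟩
    ℕtoℚ (fib n) * 1ℚ
      ≡⟨ *-identityʳ (ℕtoℚ (fib n)) ⟩
    ℕtoℚ (fib n)
      ∎
    where
    fraction : + fib n / suc n ≡ ℕtoℚ (fib n) * (+ 1 / suc n)
    fraction = sym (trans (cong₂ _*_ (ℕtoℚ≡mkℚ (fib n)) (normalize-coprime (1-coprimeTo (suc n))))
                          (/-cong (ℤ.*-identityʳ (+ fib n)) (ℕ.*-identityˡ (suc n))))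

  expFib : Series
  expFib = expS fibLogSeries

  θ-expFib-recurrence : ∀ n → θ expFib (suc (suc n)) ≡ θ expFib (suc n) + θ expFib n + expFib n
  θ-expFib-recurrence n = begin
    θ expFib (suc (suc n))
      ≡⟨ θ-expS fibLogSeries refl (suc (suc n)) ⟩
    (θ fibLogSeries ⋆ expFib) (suc (suc n))
      ≡⟨ ⋆-shiftˡ (θ fibLogSeries) expFib (suc n) (θ-zero fibLogSeries) ⟩
    ((λ i → θ fibLogSeries (suc i)) ⋆ expFib) (suc n)
      ≡⟨ ⋆-congˡ expFib (suc n) θ-fibLogSeries ⟩
    (fibℚ ⋆ expFib) (suc n)
      ≡⟨ ⋆-shiftˡ fibℚ expFib n refl ⟩
    ((λ i → fibℚ (suc i)) ⋆ expFib) n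
      ≡⟨ ⋆-congˡ expFib n fib-suc ⟩
    ((λ i → (fibℚ i + θ fibLogSeries i) + oneS i) ⋆ expFib) n
      ≡⟨ ⋆-distribʳ-+ (λ i → fibℚ i + θ fibLogSeries i) oneS expFib n ⟩
    ((λ i → fibℚ i + θ fibLogSeries i) ⋆ expFib) n + (oneS ⋆ expFib) n
      ≡⟨ cong₂ _+_ (⋆-distribʳ-+ fibℚ (θ fibLogSeries) expFib n) (⋆-identityˡ expFib n) ⟩
    (fibℚ ⋆ expFib) n + (θ fibLogSeries ⋆ expFib) n + expFib n
      ≡⟨ cong₂ (λ x y → x + y + expFib n) θ-expFib-suc (sym (θ-expS fibLogSeries refl n)) ⟩
    θ expFib (suc n) + θ expFib n + expFib n
      ∎
    where
    fibℚ : Series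
    fibℚ i = ℕtoℚ (fib i)
    fib-suc : ∀ i → fibℚ (suc i) ≡ (fibℚ i + θ fibLogSeries i) + oneS i
    fib-suc zero    = refl
    fib-suc (suc i) = begin
      ℕtoℚ (fib (suc i) ℕ.+ fib i)                                  ≡⟨ ℕtoℚ-homo-+ (fib (suc i)) (fib i) ⟩
      fibℚ (suc i) + fibℚ i                                         ≡⟨ cong (_+_ (fibℚ (suc i))) (θ-fibLogSeries i) ⟨
      fibℚ (suc i) + θ fibLogSeries (suc i)                         ≡⟨ +-identityʳ _ ⟨
      (fibℚ (suc i) + θ fibLogSeries (suc i)) + 0ℚ                  ∎
    θ-expFib-suc : (fibℚ ⋆ expFib) n ≡ θ expFib (suc n)
    θ-expFib-suc = begin
      (fibℚ ⋆ expFib) n                                   ≡⟨ ⋆-congˡ expFib n θ-fibLogSeries ⟨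
      ((λ i → θ fibLogSeries (suc i)) ⋆ expFib) n         ≡⟨ ⋆-shiftˡ (θ fibLogSeries) expFib n (θ-zero fibLogSeries) ⟨
      (θ fibLogSeries ⋆ expFib) (suc n)                   ≡⟨ θ-expS fibLogSeries refl (suc n) ⟨
      θ expFib (suc n)                                    ∎

  n!·expFib : ℕ → ℚ
  n!·expFib n = ℕtoℚ (n !) * expFib n

  n!·expFib-recurrence : ∀ n → n!·expFib (suc (suc n))
                              ≡ ℕtoℚ (suc n) * n!·expFib (suc n) + ℕtoℚ (suc n) * ℕtoℚ (suc n) * n!·expFib n
  n!·expFib-recurrence n = begin
    ℕtoℚ (suc (suc n) !) * E₂
      ≡⟨ cong (_* E₂) (ℕtoℚ-homo-* (suc (suc n)) (suc n !)) ⟩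
    t * ℕtoℚ (suc n !) * E₂
      ≡⟨ cong (λ x → t * x * E₂) (ℕtoℚ-homo-* (suc n) (n !)) ⟩
    t * (s * f) * E₂
      ≡⟨ solve 4 (λ t s f e → t :* (s :* f) :* e := s :* f :* (t :* e)) refl t s f E₂ ⟩
    s * f * θ expFib (suc (suc n))
      ≡⟨ cong (s * f *_) (θ-expFib-recurrence n) ⟩
    s * f * (s * E₁ + ℕtoℚ n * E₀ + E₀)
      ≡⟨ solve 5 (λ s f e₁ m e₀ → s :* f :* (s :* e₁ :+ m :* e₀ :+ e₀)
          := s :* f :* (s :* e₁ :+ (con 1ℚ :+ m) :* e₀)) refl s f E₁ (ℕtoℚ n) E₀ ⟩
    s * f * (s * E₁ + (1ℚ + ℕtoℚ n) * E₀)
      ≡⟨ cong (λ x → s * f * (s * E₁ + x * E₀)) (ℕtoℚ-homo-+ 1 n) ⟨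
    s * f * (s * E₁ + s * E₀)
      ≡⟨ solve 4 (λ s f e₁ e₀ → s :* f :* (s :* e₁ :+ s :* e₀)
          := s :* (s :* f :* e₁) :+ s :* s :* (f :* e₀)) refl s f E₁ E₀ ⟩
    s * (s * f * E₁) + s * s * (f * E₀)
      ≡⟨ cong (λ x → s * (x * E₁) + s * s * (f * E₀)) (ℕtoℚ-homo-* (suc n) (n !)) ⟨
    s * n!·expFib (suc n) + s * s * n!·expFib n
      ∎
    where
    t = ℕtoℚ (suc (suc n)); s = ℕtoℚ (suc n); f = ℕtoℚ (n !)
    E₀ = expFib n; E₁ = expFib (suc n); E₂ = expFib (suc (suc n))

open import Data.Nat as ℕ using (ℕ; zero; suc; _!)
open import Data.Fin using (Fin)
open import Data.Product using (Σ; _×_; _,_)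
open import Data.Rational using (_+_; _*_)
open import Function.Bundles using (_↔_)
open import Relation.Binary.PropositionalEquality using (_≡_; refl; cong₂; sym; module ≡-Reasoning)
open TreeCounting using (r5Count; Fin-r5Count↔R5Tree)
open ExponentialFormula using (ℕtoℚ-homo-+; ℕtoℚ-homo-*; n!·expFib; n!·expFib-recurrence)

r5Count≡n!·expFib : ∀ n → ℕtoℚ (r5Count n) ≡ n!·expFib n
r5Count≡n!·expFib zero          = refl
r5Count≡n!·expFib (suc zero)    = refl
r5Count≡n!·expFib (suc (suc n)) = begin
  ℕtoℚ (s ℕ.* r5Count (suc n) ℕ.+ s ℕ.* s ℕ.* r5Count n)
    ≡⟨ ℕtoℚ-homo-+ (s ℕ.* r5Count (suc n)) (s ℕ.* s ℕ.* r5Count n) ⟩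
  ℕtoℚ (s ℕ.* r5Count (suc n)) + ℕtoℚ (s ℕ.* s ℕ.* r5Count n)
    ≡⟨ cong₂ _+_ (ℕtoℚ-homo-* s (r5Count (suc n))) (ℕtoℚ-homo-* (s ℕ.* s) (r5Count n)) ⟩
  ℕtoℚ s * ℕtoℚ (r5Count (suc n)) + ℕtoℚ (s ℕ.* s) * ℕtoℚ (r5Count n)
    ≡⟨ cong₂ (λ x y → ℕtoℚ s * x + y) (r5Count≡n!·expFib (suc n))
             (cong₂ _*_ (ℕtoℚ-homo-* s s) (r5Count≡n!·expFib n)) ⟩
  ℕtoℚ s * n!·expFib (suc n) + ℕtoℚ s * ℕtoℚ s * n!·expFib n
    ≡⟨ sym (n!·expFib-recurrence n) ⟩
  n!·expFib (suc (suc n))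
    ∎
  where
  open ≡-Reasoning
  s = suc n

lemma2 : (n : ℕ) → Σ ℕ λ b → (Fin b ↔ R5Tree n) × (ℕtoℚ b ≡ ℕtoℚ (n !) * expS fibLogSeries n)
lemma2 n = r5Count n , Fin-r5Count↔R5Tree n , r5Count≡n!·expFib n
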